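{- Let $n$ be an even integer. If $m$ is an integer with $0\leq m\leq n/3$, then \[ \frac{\binom{n/2}{m}}{\binom{n+1}{2m+1}}\leq 2\Bigl(\frac{2m+1}{2(n-m+1)}\Bigr)^{m+1}. \] If $m$ is an integer with $1\leq m\leq(n+1)/3$, then \[ \frac{\binom{n/2}{m}}{\binom{n+1}{2m}}\leq\Bigl(\frac{m}{n-m+1}\Bigr)^{m}. \] -}

module Defs where

open import Data.Nat using (ℕ; zero; suc)
open import Data.Integer using (+_)
open import Data.Rational using (ℚ; _/_; _*_; 0ℚ; 1ℚ)

_^ℚ_ : ℚ → ℕ → ℚ
q ^ℚ zero = 1ℚ
q ^ℚ suc k = q * (q ^ℚ k)

infixr 8 _^ℚ_

-- the rational number a/b for natural numbers a, b (convention a/0 = 0;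
-- in the statement every denominator is positive, so the convention is never used)
frac : ℕ → ℕ → ℚ
frac a zero = 0ℚ
frac a (suc b) = (+ a) / suc b

module Submission where

open import Defs
open import Data.Nat using (ℕ; _+_; _*_; _∸_; _≤_; _/_)
open import Data.Nat.Divisibility using (_∣_)
open import Data.Nat.Combinatorics using (_C_)
open import Data.Product using (_×_)
open import Data.Rational using (ℚ) renaming (_*_ to _*ℚ_; _≤_ to _≤ℚ_)

open import Data.Nat using (zero; suc; _^_; _<_; NonZero; z<s; s≤s; z≤n)
open import Data.Nat.Properties
open import Data.Nat.DivMod using (m*[n/m]≡n)
open import Data.Nat.Combinatorics using (nC1≡n; nCk+nC[k+1]≡[n+1]C[k+1])
open import Data.Nat.Tactic.RingSolver using (solve-∀; solve)
open import Algebra.Properties.CommutativeSemigroup *-commutativeSemigroup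
  using (x∙yz≈y∙xz; interchange)
import Data.Integer as ℤ
import Data.Integer.Properties as ℤ
open import Data.Rational as ℚ using (toℚᵘ; fromℚᵘ)
import Data.Rational.Properties as ℚ
open import Data.Rational.Unnormalised as ℚᵘ using (mkℚᵘ; *≤*)
import Data.Rational.Unnormalised.Properties as ℚᵘ
open import Data.List using (_∷_; [])
open import Data.Product using (_,_; ∃)
open import Relation.Binary.PropositionalEquality

-- Lemma 4.6.  Write n = 2k, N = n + 1 = 2k + 1 and k = m + e.
--
-- 1. Exact identities.  With rise₂ x t = x(x+2)⋯(x+2t-2) we have
--      C(k,m) · rise₂ (1+2e) (m+1) = rise₂ 1 (m+1) · C(N,2m+1)        (choose-odd)
--      C(k,m) · rise₂ (3+2e) m     = rise₂ 1 m     · C(N,2m)          (choose-even)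
--    proved by induction on m from the ratio of consecutive binomial coefficients.
-- 2. Pairing.  For a progression x, x+2, … with centre w, the quotient
--    rise₂ x t / rise₂ (x+c) t is at most (w/(w+c))^t, because symmetric factors
--    pair up as (w-d)(w+d)(w+c)² ≤ w²(w-d+c)(w+d+c).  With 1. this gives
--      C(k,m)(m+1+2e)^(m+1) ≤ (m+1)^(m+1) C(N,2m+1),  C(k,m)(m+2+2e)^m ≤ m^m C(N,2m).
-- 3. Since n - m + 1 = m + 1 + 2e ≤ m + 2 + 2e, the second inequality of the lemma
--    follows directly; the first needs (2m+2)^(m+1) ≤ 2(2m+1)^(m+1), a
--    Bernoulli-type bound.
-- 4. The inequalities between natural numbers are transported to ℚ by
--    cross-multiplication.

absorption : ∀ n k → (suc n C suc k) * suc k ≡ suc n * (n C k)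
absorption zero    zero    = refl
absorption zero    (suc k) = refl
absorption (suc n) zero    = begin
  (suc (suc n) C 1) * 1 ≡⟨ *-identityʳ _ ⟩
  suc (suc n) C 1       ≡⟨ nC1≡n (suc (suc n)) ⟩
  suc (suc n)           ≡⟨ *-identityʳ _ ⟨
  suc (suc n) * 1       ∎
  where open ≡-Reasoning
absorption (suc n) (suc k) = begin
  (suc (suc n) C suc (suc k)) * suc (suc k) ≡⟨ cong (_* suc (suc k)) (pascal (suc n) (suc k)) ⟨
  (a + b) * suc (suc k)                     ≡⟨ expand a b k ⟩
  a * suc k + a + b * suc (suc k)
    ≡⟨ cong₂ (λ u v → u + a + v) (absorption n k) (absorption n (suc k)) ⟩
  suc n * c + a + suc n * d                 ≡⟨ regroup n a c d ⟩
  suc n * (c + d) + a                       ≡⟨ cong (λ u → suc n * u + a) (pascal n k) ⟩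
  suc n * a + a                             ≡⟨ +-comm (suc n * a) a ⟩
  suc (suc n) * a                           ∎
  where
  open ≡-Reasoning
  pascal = nCk+nC[k+1]≡[n+1]C[k+1]
  a = suc n C suc k
  b = suc n C suc (suc k)
  c = n C k
  d = n C suc k
  expand : ∀ a b k → (a + b) * suc (suc k) ≡ a * suc k + a + b * suc (suc k)
  expand = solve-∀
  regroup : ∀ n a c d → suc n * c + a + suc n * d ≡ suc n * (c + d) + a
  regroup = solve-∀

-- Ratio of consecutive binomial coefficients, stated without subtraction:
-- if j + r = n then (n choose j+1)·(j+1) = (n choose j)·r.
choose-ratio : ∀ {n} j r → j + r ≡ n → (n C suc j) * suc j ≡ (n C j) * r
choose-ratio j r refl = +-cancelˡ-≡ (c * suc j) _ _ (begin
  c * suc j + b * suc j          ≡⟨ *-distribʳ-+ (suc j) c b ⟨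
  (c + b) * suc j                ≡⟨ cong (_* suc j) (nCk+nC[k+1]≡[n+1]C[k+1] (j + r) j) ⟩
  (suc (j + r) C suc j) * suc j  ≡⟨ absorption (j + r) j ⟩
  suc (j + r) * c                ≡⟨ split j r c ⟩
  c * suc j + c * r              ∎)
  where
  open ≡-Reasoning
  c = (j + r) C j
  b = (j + r) C suc j
  split : ∀ j r c → suc (j + r) * c ≡ c * suc j + c * r
  split = solve-∀

choose-pos : ∀ {n k} → k ≤ n → 0 < n C k
choose-pos {n}     {zero}  _         = z<s
choose-pos {suc n} {suc k} (s≤s k≤n) =
  subst (0 <_) (nCk+nC[k+1]≡[n+1]C[k+1] n k) (≤-trans (choose-pos k≤n) (m≤m+n _ _))

rise₂ : ℕ → ℕ → ℕ
rise₂ x zero    = 1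
rise₂ x (suc t) = x * rise₂ (x + 2) t

rise₂-snoc : ∀ x t → rise₂ x (suc t) ≡ rise₂ x t * (x + 2 * t)
rise₂-snoc x zero    = solve (x ∷ [])
rise₂-snoc x (suc t) = trans (cong (x *_) (rise₂-snoc (x + 2) t)) (regroup x (rise₂ (x + 2) t) t)
  where
  regroup : ∀ x q t → x * (q * (x + 2 + 2 * t)) ≡ x * q * (x + 2 * suc t)
  regroup = solve-∀

rise₂-nonZero : ∀ y t → NonZero (rise₂ (suc y) t)
rise₂-nonZero y zero    = _
rise₂-nonZero y (suc t) = m*n≢0 (suc y) _ {{_}} {{rise₂-nonZero (y + 2) t}}

-- The algebra of the induction step of choose-even: A = C(k,m+1), B = C(k,m),
-- X, Y, Z = C(N,2m), C(N,2m+1), C(N,2m+2), with P, Q the odd products.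
choose-even-step : ∀ A B P Q X Y Z m e →
                   A * suc m ≡ B * suc e →
                   Y * suc (2 * m) ≡ X * (3 + 2 * e) →
                   Z * suc (suc (2 * m)) ≡ Y * (2 + 2 * e) →
                   B * Q ≡ P * X →
                   A * ((3 + 2 * e) * Q) ≡ (P * (1 + 2 * m)) * Z
choose-even-step A B P Q X Y Z m e hA hY hZ hB = *-cancelʳ-≡ _ _ (suc (suc (2 * m))) (begin
  A * ((3 + 2 * e) * Q) * suc (suc (2 * m))    ≡⟨ solve (A ∷ Q ∷ m ∷ e ∷ []) ⟩
  (A * suc m) * (2 * (3 + 2 * e) * Q)          ≡⟨ cong (_* (2 * (3 + 2 * e) * Q)) hA ⟩
  (B * suc e) * (2 * (3 + 2 * e) * Q)          ≡⟨ solve (B ∷ Q ∷ e ∷ []) ⟩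
  (B * Q) * ((2 + 2 * e) * (3 + 2 * e))        ≡⟨ cong (_* ((2 + 2 * e) * (3 + 2 * e))) hB ⟩
  (P * X) * ((2 + 2 * e) * (3 + 2 * e))        ≡⟨ solve (P ∷ X ∷ e ∷ []) ⟩
  P * (X * (3 + 2 * e)) * (2 + 2 * e)          ≡⟨ cong (λ u → P * u * (2 + 2 * e)) hY ⟨
  P * (Y * suc (2 * m)) * (2 + 2 * e)          ≡⟨ solve (P ∷ Y ∷ m ∷ e ∷ []) ⟩
  (P * (1 + 2 * m)) * (Y * (2 + 2 * e))        ≡⟨ cong (P * (1 + 2 * m) *_) hZ ⟨
  (P * (1 + 2 * m)) * (Z * suc (suc (2 * m)))  ≡⟨ *-assoc (P * (1 + 2 * m)) Z _ ⟨
  (P * (1 + 2 * m)) * Z * suc (suc (2 * m))    ∎)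
  where open ≡-Reasoning

-- C(k,m) / C(2k+1,2m) = ∏_{i<m} (2i+1)/(2e+2i+3)  when m + e = k.
-- Induction on m with k fixed (so e decreases).
choose-even : ∀ m e {k} → m + e ≡ k →
              (k C m) * rise₂ (3 + 2 * e) m ≡ rise₂ 1 m * ((2 * k + 1) C (2 * m))
choose-even zero    e hk = refl
choose-even (suc m) e {k} hk = begin
  A * ((3 + 2 * e) * rise₂ (3 + 2 * e + 2) m)  ≡⟨ cong (λ x → A * ((3 + 2 * e) * rise₂ x m)) (shift e) ⟩
  A * ((3 + 2 * e) * Q)
    ≡⟨ choose-even-step A B P Q X Y Z m e ratio-k ratio-N₁ ratio-N₂ ih ⟩
  (P * (1 + 2 * m)) * Z                        ≡⟨ cong₂ _*_ (rise₂-snoc 1 m) (cong (N C_) (double-suc m)) ⟨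
  rise₂ 1 (suc m) * (N C (2 * suc m))          ∎
  where
  open ≡-Reasoning
  N = 2 * k + 1
  A = k C suc m
  B = k C m
  P = rise₂ 1 m
  Q = rise₂ (3 + 2 * suc e) m
  X = N C (2 * m)
  Y = N C suc (2 * m)
  Z = N C suc (suc (2 * m))
  hk′ : m + suc e ≡ k
  hk′ = trans (+-suc m e) hk
  hN : 2 * (suc m + e) + 1 ≡ N
  hN = cong (λ k → 2 * k + 1) hk
  shift : ∀ e → 3 + 2 * e + 2 ≡ 3 + 2 * suc e
  shift = solve-∀
  split₁ : ∀ m e → 2 * m + (3 + 2 * e) ≡ 2 * (suc m + e) + 1
  split₁ = solve-∀
  split₂ : ∀ m e → suc (2 * m) + (2 + 2 * e) ≡ 2 * (suc m + e) + 1
  split₂ = solve-∀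
  double-suc : ∀ m → 2 * suc m ≡ suc (suc (2 * m))
  double-suc = solve-∀
  ratio-k : A * suc m ≡ B * suc e
  ratio-k = choose-ratio m (suc e) hk′
  ratio-N₁ : Y * suc (2 * m) ≡ X * (3 + 2 * e)
  ratio-N₁ = choose-ratio (2 * m) (3 + 2 * e) (trans (split₁ m e) hN)
  ratio-N₂ : Z * suc (suc (2 * m)) ≡ Y * (2 + 2 * e)
  ratio-N₂ = choose-ratio (suc (2 * m)) (2 + 2 * e) (trans (split₂ m e) hN)
  ih : B * Q ≡ P * X
  ih = choose-even m (suc e) hk′

-- C(k,m) / C(2k+1,2m+1) = ∏_{i≤m} (2i+1)/(2e+2i+1)  when m + e = k:
-- choose-even followed by one step along row 2k+1.
choose-odd : ∀ m e {k} → m + e ≡ k →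
             (k C m) * rise₂ (1 + 2 * e) (suc m) ≡ rise₂ 1 (suc m) * ((2 * k + 1) C suc (2 * m))
choose-odd m e {k} hk = begin
  B * ((1 + 2 * e) * rise₂ (1 + 2 * e + 2) m) ≡⟨ cong (λ x → B * ((1 + 2 * e) * rise₂ x m)) (shift e) ⟩
  B * ((1 + 2 * e) * Q)                       ≡⟨ x∙yz≈y∙xz B (1 + 2 * e) Q ⟩
  (1 + 2 * e) * (B * Q)                       ≡⟨ cong ((1 + 2 * e) *_) (choose-even m e hk) ⟩
  (1 + 2 * e) * (P * X)                       ≡⟨ x∙yz≈y∙xz (1 + 2 * e) P X ⟩
  P * ((1 + 2 * e) * X)                       ≡⟨ cong (P *_) (trans (*-comm (1 + 2 * e) X) (sym ratio-N)) ⟩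
  P * (Y * suc (2 * m))                       ≡⟨ trans (cong (P *_) (*-comm Y _)) (sym (*-assoc P _ Y)) ⟩
  (P * (1 + 2 * m)) * Y                       ≡⟨ cong (_* Y) (rise₂-snoc 1 m) ⟨
  rise₂ 1 (suc m) * Y                         ∎
  where
  open ≡-Reasoning
  N = 2 * k + 1
  B = k C m
  P = rise₂ 1 m
  Q = rise₂ (3 + 2 * e) m
  X = N C (2 * m)
  Y = N C suc (2 * m)
  shift : ∀ e → 1 + 2 * e + 2 ≡ 3 + 2 * e
  shift = solve-∀
  split : ∀ m e → 2 * m + (1 + 2 * e) ≡ 2 * (m + e) + 1
  split = solve-∀
  ratio-N : Y * suc (2 * m) ≡ X * (1 + 2 * e)
  ratio-N = choose-ratio (2 * m) (1 + 2 * e) (trans (split m e) (cong (λ k → 2 * k + 1) hk))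

-- One pair of symmetric factors: u = x and v = x+2t+2 have centre w = x+t+1, and
-- u·v·(w+c)² ≤ w²·(u+c)(v+c) because w² - uv = (t+1)².
pair-bound : ∀ x t c →
  x * (x + 2 + 2 * t) * ((x + suc t + c) * (x + suc t + c))
    ≤ ((x + suc t) * (x + suc t)) * ((x + c) * (x + c + 2 + 2 * t))
pair-bound x t c = ≤-trans (m≤m+n _ _) (≤-reflexive (sym (expand x t c)))
  where
  expand : ∀ x t c →
    ((x + suc t) * (x + suc t)) * ((x + c) * (x + c + 2 + 2 * t))
      ≡ x * (x + 2 + 2 * t) * ((x + suc t + c) * (x + suc t + c))
        + (suc t * suc t) * (2 * (x + suc t) * c + c * c)
  expand = solve-∀

combine : ∀ {u v p p′ a b w wt t tt} →
  u * v * (t * t) ≤ (w * w) * (a * b) → p * tt ≤ wt * p′ →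
  u * (p * v) * (t * (t * tt)) ≤ (w * (w * wt)) * (a * (p′ * b))
combine {u} {v} {p} {p′} {a} {b} {w} {wt} {t} {tt} outer inner = begin
  u * (p * v) * (t * (t * tt))       ≡⟨ solve (u ∷ v ∷ p ∷ t ∷ tt ∷ []) ⟩
  (u * v * (t * t)) * (p * tt)       ≤⟨ *-mono-≤ outer inner ⟩
  ((w * w) * (a * b)) * (wt * p′)    ≡⟨ solve (w ∷ a ∷ b ∷ wt ∷ p′ ∷ []) ⟩
  (w * (w * wt)) * (a * (p′ * b))    ∎
  where open ≤-Reasoning

-- The progression x, x+2, …, x+2t-2 has centre w (that is, x + t = w + 1); then
-- rise₂ x t / rise₂ (x+c) t ≤ (w/(w+c))^t.  Induction removes the outer pair of factors.
progression-ratio-bound : ∀ t x w c → x + t ≡ suc w →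
                          rise₂ x t * (w + c) ^ t ≤ w ^ t * rise₂ (x + c) t
progression-ratio-bound zero          x w c _ = ≤-refl
progression-ratio-bound (suc zero)    x w c h with refl ← suc-injective (trans (+-comm 1 x) h) = ≤-refl
progression-ratio-bound (suc (suc t)) x w c h with refl ← suc-injective (trans (sym (+-suc x (suc t))) h) = begin
  x * rise₂ (x + 2) (suc t) * (T * (T * T ^ t))
    ≡⟨ cong (λ r → x * r * (T * (T * T ^ t))) (rise₂-snoc (x + 2) t) ⟩
  x * (rise₂ (x + 2) t * (x + 2 + 2 * t)) * (T * (T * T ^ t))
    ≤⟨ combine {u = x} {p = rise₂ (x + 2) t} {a = x + c} {w = w} {t = T} (pair-bound x t c) inner ⟩
  (w * (w * w ^ t)) * ((x + c) * (rise₂ (x + c + 2) t * (x + c + 2 + 2 * t)))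
    ≡⟨ cong (λ r → w * (w * w ^ t) * ((x + c) * r)) (rise₂-snoc (x + c + 2) t) ⟨
  (w * (w * w ^ t)) * ((x + c) * rise₂ (x + c + 2) (suc t))  ∎
  where
  open ≤-Reasoning
  T = w + c
  reorder : ∀ x a b → x + a + b ≡ x + b + a
  reorder = solve-∀
  same-centre : ∀ x t → x + 2 + t ≡ suc (x + suc t)
  same-centre = solve-∀
  inner : rise₂ (x + 2) t * T ^ t ≤ w ^ t * rise₂ (x + c + 2) t
  inner = subst (λ y → rise₂ (x + 2) t * T ^ t ≤ w ^ t * rise₂ y t) (reorder x 2 c)
            (progression-ratio-bound t (x + 2) w c (same-centre x t))

cancel-common-factor : ∀ {a s t y} D P .{{_ : NonZero D}} → a * D ≡ P * y → P * s ≤ t * D → a * s ≤ t * y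
cancel-common-factor {a} {s} {t} {y} D P aD≡Py Ps≤tD = *-cancelʳ-≤ (a * s) (t * y) D (begin
  a * s * D    ≡⟨ solve (a ∷ s ∷ D ∷ []) ⟩
  a * D * s    ≡⟨ cong (_* s) aD≡Py ⟩
  P * y * s    ≡⟨ solve (P ∷ y ∷ s ∷ []) ⟩
  y * (P * s)  ≤⟨ *-monoʳ-≤ y Ps≤tD ⟩
  y * (t * D)  ≡⟨ solve (y ∷ t ∷ D ∷ []) ⟩
  t * y * D    ∎)
  where open ≤-Reasoning

odd-ratio-bound : ∀ m e {k} → m + e ≡ k →
                  (k C m) * (suc m + 2 * e) ^ suc m ≤ suc m ^ suc m * ((2 * k + 1) C suc (2 * m))
odd-ratio-bound m e {k} hk =
  cancel-common-factor {a = k C m} {t = suc m ^ suc m} (rise₂ (1 + 2 * e) (suc m)) (rise₂ 1 (suc m))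
    {{rise₂-nonZero (2 * e) (suc m)}}
    (choose-odd m e hk) (progression-ratio-bound (suc m) 1 (suc m) (2 * e) refl)

even-ratio-bound : ∀ m e {k} → m + e ≡ k →
                   (k C m) * (m + (2 + 2 * e)) ^ m ≤ m ^ m * ((2 * k + 1) C (2 * m))
even-ratio-bound m e {k} hk =
  cancel-common-factor {a = k C m} {t = m ^ m} (rise₂ (3 + 2 * e) m) (rise₂ 1 m)
    {{rise₂-nonZero (2 + 2 * e) m}}
    (choose-even m e hk) (progression-ratio-bound m 1 m (2 + 2 * e) refl)

bernoulli-gap : ∀ z k → (1 + z) ^ suc k ≤ z ^ suc k + suc k * (1 + z) ^ k
bernoulli-gap z zero    = ≤-reflexive (base z)
  where
  base : ∀ z → (1 + z) * 1 ≡ z * 1 + 1 * 1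
  base = solve-∀
bernoulli-gap z (suc k) = begin
  (1 + z) * (1 + z) ^ suc k                       ≤⟨ *-monoʳ-≤ (1 + z) (bernoulli-gap z k) ⟩
  (1 + z) * (z ^ suc k + suc k * (1 + z) ^ k)     ≡⟨ expand z k (z ^ suc k) ((1 + z) ^ k) ⟩
  z ^ suc (suc k) + z ^ suc k + suc k * (1 + z) ^ suc k
    ≤⟨ +-monoˡ-≤ _ (+-monoʳ-≤ (z ^ suc (suc k)) (^-monoˡ-≤ (suc k) (n≤1+n z))) ⟩
  z ^ suc (suc k) + (1 + z) ^ suc k + suc k * (1 + z) ^ suc k
    ≡⟨ +-assoc (z ^ suc (suc k)) _ _ ⟩
  z ^ suc (suc k) + suc (suc k) * (1 + z) ^ suc k ∎
  where
  open ≤-Reasoning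
  expand : ∀ z k Z W → (1 + z) * (Z + suc k * W) ≡ z * Z + Z + suc k * ((1 + z) * W)
  expand = solve-∀

^-distribʳ-* : ∀ a b k → (a * b) ^ k ≡ a ^ k * b ^ k
^-distribʳ-* a b zero    = refl
^-distribʳ-* a b (suc k) = trans (cong (a * b *_) (^-distribʳ-* a b k)) (interchange a b (a ^ k) (b ^ k))

double-bound : ∀ m → (2 * suc m) ^ suc m ≤ 2 * (1 + 2 * m) ^ suc m
double-bound m = subst (λ b → b ^ suc m ≤ 2 * V) (sym (double-suc m)) (+-cancelʳ-≤ W W (2 * V) (begin
  W + W                 ≡⟨ cong (W +_) (+-identityʳ W) ⟨
  2 * W                 ≤⟨ *-monoʳ-≤ 2 (bernoulli-gap (1 + 2 * m) m) ⟩
  2 * (V + suc m * U)   ≡⟨ regroup m V U ⟩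
  2 * V + W             ∎))
  where
  open ≤-Reasoning
  U = (2 + 2 * m) ^ m
  V = (1 + 2 * m) ^ suc m
  W = (2 + 2 * m) ^ suc m
  double-suc : ∀ m → 2 * suc m ≡ 2 + 2 * m
  double-suc = solve-∀
  regroup : ∀ m V U → 2 * (V + suc m * U) ≡ 2 * V + (2 + 2 * m) * U
  regroup = solve-∀

complement-succ : ∀ m e → 2 * (m + e) ∸ m + 1 ≡ suc m + 2 * e
complement-succ m e = begin
  2 * (m + e) ∸ m + 1     ≡⟨ cong (λ x → x ∸ m + 1) (split m e) ⟩
  m + (m + 2 * e) ∸ m + 1 ≡⟨ cong (_+ 1) (m+n∸m≡n m (m + 2 * e)) ⟩
  m + 2 * e + 1           ≡⟨ +-comm (m + 2 * e) 1 ⟩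
  suc m + 2 * e           ∎
  where
  open ≡-Reasoning
  split : ∀ m e → 2 * (m + e) ≡ m + (m + 2 * e)
  split = solve-∀

odd-bound-ℕ : ∀ m e {k n} → m + e ≡ k → 2 * k ≡ n →
  (k C m) * (2 * (n ∸ m + 1)) ^ (m + 1) ≤ 2 * (2 * m + 1) ^ (m + 1) * ((n + 1) C (2 * m + 1))
odd-bound-ℕ m e refl refl rewrite complement-succ m e | +-comm m 1 | +-comm (2 * m) 1 = begin
  B * (2 * s) ^ suc m                   ≡⟨ cong (B *_) (^-distribʳ-* 2 s (suc m)) ⟩
  B * (2 ^ suc m * s ^ suc m)           ≡⟨ x∙yz≈y∙xz B (2 ^ suc m) (s ^ suc m) ⟩
  2 ^ suc m * (B * s ^ suc m)           ≤⟨ *-monoʳ-≤ (2 ^ suc m) (odd-ratio-bound m e refl) ⟩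
  2 ^ suc m * (suc m ^ suc m * Y)       ≡⟨ *-assoc (2 ^ suc m) _ Y ⟨
  2 ^ suc m * suc m ^ suc m * Y         ≡⟨ cong (_* Y) (^-distribʳ-* 2 (suc m) (suc m)) ⟨
  (2 * suc m) ^ suc m * Y               ≤⟨ *-monoˡ-≤ Y (double-bound m) ⟩
  2 * (1 + 2 * m) ^ suc m * Y           ∎
  where
  open ≤-Reasoning
  B = (m + e) C m
  s = suc m + 2 * e
  Y = (2 * (m + e) + 1) C suc (2 * m)

even-bound-ℕ : ∀ m e {k n} → m + e ≡ k → 2 * k ≡ n →
  (k C m) * (n ∸ m + 1) ^ m ≤ m ^ m * ((n + 1) C (2 * m))
even-bound-ℕ m e refl refl rewrite complement-succ m e = begin
  B * (suc m + 2 * e) ^ m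
    ≤⟨ *-monoʳ-≤ B (^-monoˡ-≤ m (≤-trans (n≤1+n _) (≤-reflexive (shift m e)))) ⟩
  B * (m + (2 + 2 * e)) ^ m               ≤⟨ even-ratio-bound m e refl ⟩
  m ^ m * ((2 * (m + e) + 1) C (2 * m))   ∎
  where
  open ≤-Reasoning
  B = (m + e) C m
  shift : ∀ m e → suc (suc m + 2 * e) ≡ m + (2 + 2 * e)
  shift = solve-∀

frac-* : ∀ {a b c d} → 0 < b → 0 < d → frac a b *ℚ frac c d ≡ frac (a * c) (b * d)
frac-* {a} {suc b} {c} {suc d} _ _ = ℚ.toℚᵘ-injective (begin
  toℚᵘ (fromℚᵘ p *ℚ fromℚᵘ q)              ≈⟨ ℚ.toℚᵘ-homo-* (fromℚᵘ p) (fromℚᵘ q) ⟩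
  toℚᵘ (fromℚᵘ p) ℚᵘ.* toℚᵘ (fromℚᵘ q)
    ≈⟨ ℚᵘ.*-cong (ℚ.toℚᵘ-fromℚᵘ p) (ℚ.toℚᵘ-fromℚᵘ q) ⟩
  p ℚᵘ.* q                                 ≡⟨ cong (λ z → mkℚᵘ z (d + b * suc d)) (ℤ.pos-* a c) ⟨
  mkℚᵘ (ℤ.+ (a * c)) (d + b * suc d)       ≈⟨ ℚ.toℚᵘ-fromℚᵘ _ ⟨
  toℚᵘ (frac (a * c) (suc b * suc d))      ∎)
  where
  open ℚᵘ.≃-Reasoning
  p = mkℚᵘ (ℤ.+ a) b
  q = mkℚᵘ (ℤ.+ c) d

pow-pos : ∀ {d} j → 0 < d → 0 < d ^ j
pow-pos {suc d} j _ = m^n>0 (suc d) j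

frac-^ : ∀ {a b} j → 0 < b → frac a b ^ℚ j ≡ frac (a ^ j) (b ^ j)
frac-^         zero    _   = refl
frac-^ {a} {b} (suc j) 0<b = begin
  frac a b *ℚ frac a b ^ℚ j          ≡⟨ cong (frac a b *ℚ_) (frac-^ j 0<b) ⟩
  frac a b *ℚ frac (a ^ j) (b ^ j)   ≡⟨ frac-* 0<b (pow-pos j 0<b) ⟩
  frac (a ^ suc j) (b ^ suc j)       ∎
  where open ≡-Reasoning

frac-≤ : ∀ {a b c d} → 0 < b → 0 < d → a * d ≤ c * b → frac a b ≤ℚ frac c d
frac-≤ {a} {suc b} {c} {suc d} _ _ ad≤cb = ℚ.toℚᵘ-cancel-≤
  (ℚᵘ.≤-respˡ-≃ (ℚᵘ.≃-sym (ℚ.toℚᵘ-fromℚᵘ (mkℚᵘ (ℤ.+ a) b)))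
    (ℚᵘ.≤-respʳ-≃ (ℚᵘ.≃-sym (ℚ.toℚᵘ-fromℚᵘ (mkℚᵘ (ℤ.+ c) d)))
      (*≤* (subst₂ ℤ._≤_ (ℤ.pos-* a (suc d)) (ℤ.pos-* c (suc b)) (ℤ.+≤+ ad≤cb)))))

frac-≤-power : ∀ {a b c d} j → 0 < b → 0 < d → a * d ^ j ≤ c ^ j * b → frac a b ≤ℚ frac c d ^ℚ j
frac-≤-power j 0<b 0<d h = subst (_ ≤ℚ_) (sym (frac-^ j 0<d)) (frac-≤ 0<b (pow-pos j 0<d) h)

frac-≤-twice-power : ∀ {a b c d} j → 0 < b → 0 < d → a * d ^ j ≤ 2 * c ^ j * b →
                     frac a b ≤ℚ frac 2 1 *ℚ frac c d ^ℚ j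
frac-≤-twice-power {a} {b} {c} {d} j 0<b 0<d h = subst (_ ≤ℚ_) (sym twice-power)
  (frac-≤ 0<b (subst (0 <_) (sym (*-identityˡ (d ^ j))) (pow-pos j 0<d))
    (subst (λ x → a * x ≤ 2 * c ^ j * b) (sym (*-identityˡ (d ^ j))) h))
  where
  twice-power : frac 2 1 *ℚ frac c d ^ℚ j ≡ frac (2 * c ^ j) (1 * d ^ j)
  twice-power = trans (cong (frac 2 1 *ℚ_) (frac-^ j 0<d)) (frac-* {2} {1} {c ^ j} z<s (pow-pos j 0<d))

-- 3m ≤ 2k + 1 forces m ≤ k, so k = m + e; this is all the hypotheses on m are needed for.
split-half : ∀ {m k n} → 2 * k ≡ n → 3 * m ≤ n + 1 → ∃ λ e → m + e ≡ k
split-half {k = k} refl h = m≤n⇒∃[o]m+o≡n (m≤k _ h)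
  where
  thirds : ∀ m → 2 * suc m + 1 + m ≡ 3 * suc m
  thirds = solve-∀
  m≤k : ∀ m → 3 * m ≤ 2 * k + 1 → m ≤ k
  m≤k zero    _ = z≤n
  m≤k (suc m) h =
    *-cancelˡ-≤ 2 (+-cancelʳ-≤ 1 _ _ (≤-trans (≤-trans (m≤m+n _ m) (≤-reflexive (thirds m))) h))

2m≤3m : ∀ m → 2 * m ≤ 3 * m
2m≤3m m = *-monoˡ-≤ m (n≤1+n 2)

odd-bound : ∀ {k n} m → 2 * k ≡ n → 3 * m ≤ n →
  frac (k C m) ((n + 1) C (2 * m + 1)) ≤ℚ frac 2 1 *ℚ (frac (2 * m + 1) (2 * (n ∸ m + 1)) ^ℚ (m + 1))
odd-bound {n = n} m 2k≡n 3m≤n with (e , m+e≡k) ← split-half 2k≡n (≤-trans 3m≤n (m≤m+n n 1)) =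
  frac-≤-twice-power (m + 1)
    (choose-pos (+-monoˡ-≤ 1 (≤-trans (2m≤3m m) 3m≤n)))
    (≤-trans (m≤n+m 1 (n ∸ m)) (m≤m+n _ _))
    (odd-bound-ℕ m e m+e≡k 2k≡n)

even-bound : ∀ {k n} m → 2 * k ≡ n → 3 * m ≤ n + 1 →
  frac (k C m) ((n + 1) C (2 * m)) ≤ℚ frac m (n ∸ m + 1) ^ℚ m
even-bound {n = n} m 2k≡n 3m≤n+1 with (e , m+e≡k) ← split-half 2k≡n 3m≤n+1 =
  frac-≤-power m
    (choose-pos (≤-trans (2m≤3m m) 3m≤n+1))
    (m≤n+m 1 (n ∸ m))
    (even-bound-ℕ m e m+e≡k 2k≡n)

lemma4p6 : (n : ℕ) → 2 ∣ n →
    ((m : ℕ) → 3 * m ≤ n →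
      frac ((n / 2) C m) ((n + 1) C (2 * m + 1))
        ≤ℚ frac 2 1 *ℚ (frac (2 * m + 1) (2 * (n ∸ m + 1)) ^ℚ (m + 1)))
    × ((m : ℕ) → 1 ≤ m → 3 * m ≤ n + 1 →
      frac ((n / 2) C m) ((n + 1) C (2 * m))
        ≤ℚ frac m (n ∸ m + 1) ^ℚ m)
lemma4p6 n 2∣n = (λ m → odd-bound m half) , (λ m _ → even-bound m half)
  where
  half : 2 * (n / 2) ≡ n
  half = m*[n/m]≡n 2∣n
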